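{- Let $\mathcal X=(\Omega,S)$ be a scheme satisfying the $e_1/e_0$-condition, let $\mathcal X'$ be a scheme on $\Omega'$, and let $\varphi:\mathcal X\to\mathcal X'$ be an algebraic isomorphism. Then a bijection $f:\Omega\to\Omega'$ belongs to $\mathrm{Iso}(\mathcal X,\mathcal X',\varphi)$ if and only if $f$ is induced by an $e_1/e_0$-admissible pair $(\{f_\Delta\}_{\Delta\in\Omega_1},f_0)$ such that $f_0\in\mathrm{Iso}(\mathcal X_0,\mathcal X'_0,\varphi_0)$ and $f_\Delta\in\mathrm{Iso}(\mathcal X_\Delta,\mathcal X'_{\Delta'},\varphi_{\Delta,\Delta'})$ for all $\Delta\in\Omega_1$.
   Context: A coherent configuration $\mathcal X=(\Omega,S)$ ($\Omega$ finite) is a partition $S$ of $\Omega^2$ with $1_\Omega$ a union of elements of $S$, closed under transposition, with intersection numbers $c_{rs}^t=|\alpha r\cap\beta s^*|$ independent of $(\alpha,\beta)\in t$; it is a scheme if $1_\Omega\in S$. Basis relations: elements of $S$; relations: unions; parabolics: relations that are equivalence relations. An algebraic isomorphism $\varphi:\mathcal X\to\mathcal X'=(\Omega',S')$ is a bijection $S\to S'$ preserving intersection numbers, extended to relations by unions; $\mathrm{Iso}(\mathcal X,\mathcal X',\varphi)$ is the set of bijections $f$ with $s^f=\varphi(s)$ for all $s\in S$. For an equivalence relation $e$ and $s\subseteq\Omega^2$, $s_{\Omega/e}=\{(\Gamma,\Gamma')\in(\Omega/e)^2:s\cap(\Gamma\times\Gamma')\ne\emptyset\}$; the radical $\mathrm{rad}(s)$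 is the largest equivalence relation $e$ with $s=\bigcup_{(\Gamma,\Gamma')\in s_{\Omega/e}}\Gamma\times\Gamma'$. For parabolics $e_0\subseteq e_1$ of a scheme $\mathcal X$, $\mathcal X$ satisfies the $e_1/e_0$-condition if $s\cap e_1=\emptyset$ implies $e_0\subseteq\mathrm{rad}(s)$ for every $s\in S$. Notation: $\Omega_0=\Omega/e_0$, $\mathcal X_0=(\Omega_0,\{s_{\Omega/e_0}:s\in S\})$, $\Omega_1=\Omega/e_1$, and for $\Delta\in\Omega_1$, $\Delta_0=\Delta/e_0\subseteq\Omega_0$ and $\mathcal X_\Delta$ is the scheme on $\Delta$ with basis relations the nonempty $s\cap\Delta^2$. Let $e_i'=\varphi(e_i)$ (parabolics of $\mathcal X'$) and define $\Omega'_0,\Omega'_1,\mathcal X'_0,\Delta'_0$ analogously. $\varphi_0:\mathcal X_0\to\mathcal X'_0$ is the algebraic isomorphism $s_{\Omega/e_0}\mapsto\varphi(s)_{\Omega'/e'_0}$, and for $\Delta\in\Omega_1,\Delta'\in\Omega'_1$, $\varphi_{\Delta,\Delta'}:\mathcal X_\Delta\to\mathcal X'_{\Delta'}$ is $s\cap\Delta^2\mapsto\varphi(s)\cap\Delta'^2$. An $e_1/e_0$-admissible pair is $(\{f_\Delta\}_{\Delta\in\Omega_1},f_0)$ where $f_0:\Omega_0\to\Omega'_0$ is a bijection mapping the equivalence relation on $\Omega_0$ induced by $e_1$ onto the one on $\Omega'_0$ induced by $e'_1$, and for each $\Delta\in\Omega_1$, $f_\Delta:\Delta\to\Delta'$ is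 a bijection onto the unique $\Delta'\in\Omega'_1$ with $\Delta_0^{f_0}=\Delta'_0$, such that $f_\Delta$ maps $e_0$-classes in $\Delta$ onto $e'_0$-classes and the induced map $\Delta_0\to\Delta'_0$ equals the restriction of $f_0$ to $\Delta_0$. Such a pair induces the unique bijection $f:\Omega\to\Omega'$ whose induced map $\Omega_0\to\Omega'_0$ is $f_0$ and whose restriction to each $\Delta\in\Omega_1$ is $f_\Delta$. -}

module Defs where

open import Level using (0ℓ)
open import Data.Nat using (ℕ)
open import Data.Fin using (Fin; _≟_)
open import Data.List using (length; filter; allFin)
open import Data.Product using (Σ; ∃-syntax; _×_; _,_)
open import Relation.Nullary using (¬_)
open import Relation.Nullary.Decidable using (_×-dec_)
open import Relation.Unary using (Pred)
open import Relation.Binary.Core using (Rel)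
open import Relation.Binary.Structures using (IsEquivalence)
open import Relation.Binary.PropositionalEquality using (_≡_)
open import Function.Bundles using (_⇔_)
open import Function.Definitions using (Injective; Surjective)

-- The partition S of Ω² is encoded by a colouring  col : Ω → Ω → Fin rk,
-- the colour s ∈ Fin rk naming the basis relation {(α,β) | col α β ≡ s}.
-- Surjectivity of col = all blocks of the partition are nonempty.

intNum : ∀ {n rk} → (Fin n → Fin n → Fin rk) →
         Fin n → Fin n → Fin rk → Fin rk → ℕ
intNum {n} col α β r s =
  length (filter (λ γ → (col α γ ≟ r) ×-dec (col γ β ≟ s)) (allFin n))

record CC (n : ℕ) : Set where
  field
    rk       : ℕ
    col      : Fin n → Fin n → Fin rk
    nonempty : ∀ s → ∃[ α ] ∃[ β ] col α β ≡ s
    -- 1_Ω is a union of basis relations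
    diagUnion : ∀ α β γ → col β γ ≡ col α α → β ≡ γ
    transp   : ∀ s → ∃[ t ] (∀ α β → (col α β ≡ s) ⇔ (col β α ≡ t))
    intConst : ∀ r s t α β α′ β′ → col α β ≡ t → col α′ β′ ≡ t →
               intNum col α β r s ≡ intNum col α′ β′ r s
open CC public

IsScheme : ∀ {n} → CC n → Set
IsScheme X = ∃[ i ] (∀ α β → (col X α β ≡ i) ⇔ (α ≡ β))

-- relations of X = unions of basis relations = sets of colours
Relation : ∀ {n} → CC n → Set₁
Relation X = Pred (Fin (rk X)) 0ℓ

Mem : ∀ {n} (X : CC n) → Relation X → Rel (Fin n) 0ℓ
Mem X R α β = R (col X α β)

IsParabolic : ∀ {n} (X : CC n) → Relation X → Set
IsParabolic X R = IsEquivalence (Mem X R)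

_⊆ᴿ_ : ∀ {n} → Rel (Fin n) 0ℓ → Rel (Fin n) 0ℓ → Set
R ⊆ᴿ R′ = ∀ α β → R α β → R′ α β

-- s_{Ω/e} evaluated at the classes of α and β:
-- s meets [α]_e × [β]_e
Lift : ∀ {n} → Rel (Fin n) 0ℓ → Rel (Fin n) 0ℓ → Rel (Fin n) 0ℓ
Lift e s α β = ∃[ α′ ] ∃[ β′ ] (e α α′ × e β β′ × s α′ β′)

-- s = ⋃_{(Γ,Γ′) ∈ s_{Ω/e}} Γ × Γ′
BlockUnion : ∀ {n} → Rel (Fin n) 0ℓ → Rel (Fin n) 0ℓ → Set
BlockUnion s e = ∀ α β → s α β ⇔ Lift e s α β

IsRadical : ∀ {n} → Rel (Fin n) 0ℓ → Rel (Fin n) 0ℓ → Set₁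
IsRadical s e = IsEquivalence e × BlockUnion s e ×
  (∀ (e′ : Rel (Fin _) 0ℓ) → IsEquivalence e′ → BlockUnion s e′ → e′ ⊆ᴿ e)

Condition : ∀ {n} (X : CC n) (e1 e0 : Relation X) → Set₁
Condition X e1 e0 = ∀ s →
  (∀ α β → col X α β ≡ s → ¬ Mem X e1 α β) →
  Σ (Rel (Fin _) 0ℓ) λ r →
    IsRadical (λ α β → col X α β ≡ s) r × (Mem X e0 ⊆ᴿ r)

record AlgIso {n n′} (X : CC n) (X′ : CC n′) : Set where
  field
    φ      : Fin (rk X) → Fin (rk X′)
    φ-inj  : Injective _≡_ _≡_ φ
    φ-surj : Surjective _≡_ _≡_ φ
    φ-int  : ∀ r s t α β α′ β′ → col X α β ≡ t → col X′ α′ β′ ≡ φ t →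
             intNum (col X) α β r s ≡ intNum (col X′) α′ β′ (φ r) (φ s)
open AlgIso public

image : ∀ {n n′} {X : CC n} {X′ : CC n′} → AlgIso X X′ → Relation X → Relation X′
image Φ R s′ = ∃[ s ] (R s × φ Φ s ≡ s′)

IsIso : ∀ {n n′} {X : CC n} {X′ : CC n′} → AlgIso X X′ → (Fin n → Fin n′) → Set
IsIso {X = X} {X′} Φ f =
  ∀ s α β → (col X α β ≡ s) ⇔ (col X′ (f α) (f β) ≡ φ Φ s)

-- Quotients are handled by representatives:
--  * f0 : Ω/e0 → Ω′/e0′ is given by F0 on representatives, compatible with
--    e0/e0′ and bijective on classes;
--  * the family {f_Δ}_{Δ ∈ Ω/e1} is given by FΔ δ (= f_Δ for Δ = [δ]_{e1}),
--    independent of the representative δ; Δ′ is the e1′-class of F0 δ.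
module _ {n n′} {X : CC n} {X′ : CC n′} (Φ : AlgIso X X′) (e0 e1 : Relation X) where
  private
    E0 = Mem X e0
    E1 = Mem X e1
    E0′ = Mem X′ (image Φ e0)
    E1′ = Mem X′ (image Φ e1)

  record AdmissiblePair : Set where
    field
      F0      : Fin n → Fin n′
      F0-wd   : ∀ α β → E0 α β → E0′ (F0 α) (F0 β)
      F0-inj  : ∀ α β → E0′ (F0 α) (F0 β) → E0 α β
      F0-surj : ∀ β′ → ∃[ α ] E0′ (F0 α) β′
      -- f0 maps the equivalence on Ω0 induced by e1 onto that induced by e1′
      F0-e1   : ∀ α β → Lift E0 E1 α β ⇔ Lift E0′ E1′ (F0 α) (F0 β)
      FΔ      : Fin n → Fin n → Fin n′
      FΔ-wd   : ∀ δ δ′ α → E1 δ δ′ → E1 δ α → FΔ δ α ≡ FΔ δ′ α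
      FΔ-into : ∀ δ α → E1 δ α → E1′ (F0 δ) (FΔ δ α)
      FΔ-inj  : ∀ δ α β → E1 δ α → E1 δ β → FΔ δ α ≡ FΔ δ β → α ≡ β
      FΔ-surj : ∀ δ β′ → E1′ (F0 δ) β′ → ∃[ α ] (E1 δ α × FΔ δ α ≡ β′)
      FΔ-cls-into : ∀ δ α β → E1 δ α → E0 α β → E0′ (FΔ δ α) (FΔ δ β)
      FΔ-cls-onto : ∀ δ α β′ → E1 δ α → E0′ (FΔ δ α) β′ →
                    ∃[ β ] (E0 α β × FΔ δ β ≡ β′)
      -- the induced map Δ0 → Δ′0 is the restriction of f0
      FΔ-induced  : ∀ δ α → E1 δ α → E0′ (FΔ δ α) (F0 α)
  open AdmissiblePair public

  Induces : AdmissiblePair → (Fin n → Fin n′) → Set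
  Induces P f = (∀ α → E0′ (f α) (F0 P α)) ×
                (∀ δ α → E1 δ α → f α ≡ FΔ P δ α)

  F0Iso : AdmissiblePair → Set
  F0Iso P = ∀ s α β →
    Lift E0 (λ x y → col X x y ≡ s) α β ⇔
    Lift E0′ (λ x y → col X′ x y ≡ φ Φ s) (F0 P α) (F0 P β)

  FΔIso : AdmissiblePair → Set
  FΔIso P = ∀ δ s →
    (∃[ α ] ∃[ β ] (E1 δ α × E1 δ β × col X α β ≡ s)) →
    ∀ α β → E1 δ α → E1 δ β →
    (col X α β ≡ s) ⇔ (col X′ (FΔ P δ α) (FΔ P δ β) ≡ φ Φ s)

-- Inside e1 the colour of (f α, f β) is prescribed by the isomorphism f_Δ of the fibre of α.
-- Outside e1 the e1/e0-condition makes the basis relation s of (α, β) a union of e0-blocks, and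
-- the intersection numbers force φ(s) to be a union of e0′-blocks too; since f α and f β lie in the
-- e0′-classes f0[α] and f0[β], and f0 maps some pair of those classes into φ(s), (f α, f β) ∈ φ(s).
-- Conversely an isomorphism f induces the pair f0 = f, f_Δ = f|_Δ.
module Submission where

open import Defs
open import Level using (0ℓ)
open import Data.Nat using (_<_)
open import Data.Fin using (Fin; _≟_)
open import Data.List using (List; length; allFin)
open import Data.List.Properties using (filter-some)
open import Data.List.Relation.Unary.All using (All; _∷_)
open import Data.List.Relation.Unary.All.Properties using (all-filter)
open import Data.List.Membership.Propositional using (lose)
open import Data.List.Membership.Propositional.Properties using (∈-allFin)
open import Data.Product using (Σ; ∃; ∃-syntax; _×_; _,_; proj₁; proj₂)
open import Relation.Nullary using (¬_; Dec; yes; no)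
open import Relation.Nullary.Decidable using (decidable-stable; ¬¬-excluded-middle)
open import Relation.Unary using (Pred)
open import Relation.Binary.Core using (Rel)
open import Relation.Binary.Definitions using (Reflexive)
open import Relation.Binary.Structures using (IsEquivalence)
open import Relation.Binary.PropositionalEquality
  using (_≡_; refl; sym; trans; cong; subst; subst₂)
open import Function.Bundles using (_⇔_; mk⇔; Equivalence)
open import Function.Definitions using (Injective; StrictlySurjective; Bijective)
open import Function.Consequences using (surjective⇒strictlySurjective)

open Equivalence using (to; from)

nonempty-All⇒∃ : ∀ {a p} {A : Set a} {P : Pred A p} {xs : List A} →
                 All P xs → 0 < length xs → ∃ P
nonempty-All⇒∃ (px ∷ _) _ = _ , px

Triangle : ∀ {n k} → (Fin n → Fin n → Fin k) → Fin n → Fin n → Fin k → Fin k → Set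
Triangle col α β r s = ∃[ γ ] (col α γ ≡ r × col γ β ≡ s)

module _ {n k} (col : Fin n → Fin n → Fin k) {α β : Fin n} {r s : Fin k} where

  triangle⇒0<intNum : Triangle col α β r s → 0 < intNum col α β r s
  triangle⇒0<intNum (γ , αγ , γβ) = filter-some _ (lose (∈-allFin γ) (αγ , γβ))

  0<intNum⇒triangle : 0 < intNum col α β r s → Triangle col α β r s
  0<intNum⇒triangle = nonempty-All⇒∃ (all-filter _ (allFin n))

Saturated : ∀ {n} → Rel (Fin n) 0ℓ → Rel (Fin n) 0ℓ → Set
Saturated e s = ∀ {α β} → Lift e s α β → s α β

module _ {n} {e s : Rel (Fin n) 0ℓ} (e-refl : Reflexive e) (sat : Saturated e s) where

  saturatedˡ : ∀ {α β γ} → e α γ → s γ β → s α β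
  saturatedˡ αγ γβ = sat (_ , _ , αγ , e-refl , γβ)

  saturatedʳ : ∀ {α β γ} → s α γ → e β γ → s α β
  saturatedʳ αγ βγ = sat (_ , _ , e-refl , βγ , αγ)

BlockUnion⇒Saturated : ∀ {n} {s e r : Rel (Fin n) 0ℓ} → BlockUnion s r → e ⊆ᴿ r → Saturated e s
BlockUnion⇒Saturated bu e⊆r (α₁ , β₁ , αα₁ , ββ₁ , α₁β₁) =
  from (bu _ _) (α₁ , β₁ , e⊆r _ _ αα₁ , e⊆r _ _ ββ₁ , α₁β₁)

module _ {n n′} {e s : Rel (Fin n) 0ℓ} {e′ s′ : Rel (Fin n′) 0ℓ} {f : Fin n → Fin n′} where

  Lift-map : (∀ {x y} → e x y → e′ (f x) (f y)) → (∀ {x y} → s x y → s′ (f x) (f y)) →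
             ∀ {α β} → Lift e s α β → Lift e′ s′ (f α) (f β)
  Lift-map e⇒ s⇒ (α₁ , β₁ , αα₁ , ββ₁ , α₁β₁) = f α₁ , f β₁ , e⇒ αα₁ , e⇒ ββ₁ , s⇒ α₁β₁

  Lift-reflect : StrictlySurjective _≡_ f →
                 (∀ {x y} → e′ (f x) (f y) → e x y) → (∀ {x y} → s′ (f x) (f y) → s x y) →
                 ∀ {α β} → Lift e′ s′ (f α) (f β) → Lift e s α β
  Lift-reflect surj e⇐ s⇐ (α₁′ , β₁′ , αα₁ , ββ₁ , α₁β₁) with surj α₁′ | surj β₁′
  ... | α₁ , refl | β₁ , refl = α₁ , β₁ , e⇐ αα₁ , e⇐ ββ₁ , s⇐ α₁β₁

  Lift-transport : StrictlySurjective _≡_ f →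
                   (∀ {x y} → e x y ⇔ e′ (f x) (f y)) → (∀ {x y} → s x y ⇔ s′ (f x) (f y)) →
                   ∀ {α β} → Lift e s α β ⇔ Lift e′ s′ (f α) (f β)
  Lift-transport surj e⇔ s⇔ =
    mk⇔ (Lift-map (to e⇔) (to s⇔)) (Lift-reflect surj (from e⇔) (from s⇔))

BasisRel : ∀ {n} (X : CC n) → Fin (rk X) → Rel (Fin n) 0ℓ
BasisRel X s α β = col X α β ≡ s

module _ {n n′} {X : CC n} {X′ : CC n′} (Φ : AlgIso X X′) where

  φ-strictlySurjective : StrictlySurjective _≡_ (φ Φ)
  φ-strictlySurjective = surjective⇒strictlySurjective _≡_ refl (φ-surj Φ)

  triangle-reflect : ∀ {α′ β′ r s u} → col X′ α′ β′ ≡ φ Φ u →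
                     Triangle (col X′) α′ β′ (φ Φ r) (φ Φ s) →
                     ∃[ α ] ∃[ β ] (col X α β ≡ u × Triangle (col X) α β r s)
  triangle-reflect {α′} {β′} {r} {s} {u} α′β′ t′ =
    let α , β , αβ = nonempty X u
        counts = φ-int Φ r s u α β α′ β′ αβ α′β′
    in α , β , αβ ,
       0<intNum⇒triangle (col X) (subst (0 <_) (sym counts) (triangle⇒0<intNum (col X′) t′))

  -- Each step realises the relevant triangle of X′ in X, where s absorbs R.
  saturated-image : ∀ {R s} → Reflexive (Mem X R) → Saturated (Mem X R) (BasisRel X s) →
                    Saturated (Mem X′ (image Φ R)) (BasisRel X′ (φ Φ s))
  saturated-image {R} {s} R-refl sat (α₁ , β₁ , αα₁ , ββ₁ , α₁β₁) = stepʳ (stepˡ αα₁ α₁β₁) ββ₁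
    where
    stepˡ : ∀ {α′ β′ γ′} → Mem X′ (image Φ R) α′ γ′ → col X′ γ′ β′ ≡ φ Φ s →
            col X′ α′ β′ ≡ φ Φ s
    stepˡ {α′} {β′} {γ′} (a , Ra , φa) γ′β′
      with u , φu ← φ-strictlySurjective (col X′ α′ β′)
      with α , β , αβ , γ , αγ , γβ ← triangle-reflect (sym φu) (γ′ , sym φa , γ′β′)
      = trans (sym φu) (cong (φ Φ) (trans (sym αβ) (saturatedˡ R-refl sat (subst R (sym αγ) Ra) γβ)))

    stepʳ : ∀ {α′ β′ γ′} → col X′ α′ γ′ ≡ φ Φ s → Mem X′ (image Φ R) β′ γ′ →
            col X′ α′ β′ ≡ φ Φ s
    stepʳ {α′} {β′} {γ′} α′γ′ (b , Rb , φb)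
      with u , φu ← φ-strictlySurjective (col X′ α′ β′)
      with α , γ , αγ , β , αβ , βγ ← triangle-reflect α′γ′ (β′ , sym φu , sym φb)
      = trans (sym φu) (cong (φ Φ) (trans (sym αβ) (saturatedʳ R-refl sat αγ (subst R (sym βγ) Rb))))

module _ {n n′} {X : CC n} {X′ : CC n′} (Φ : AlgIso X X′) {f : Fin n → Fin n′} where

  PreservesColours : Set
  PreservesColours = ∀ α β → col X′ (f α) (f β) ≡ φ Φ (col X α β)

  IsIso⇔PreservesColours : IsIso Φ f ⇔ PreservesColours
  IsIso⇔PreservesColours = mk⇔
    (λ iso α β → to (iso (col X α β) α β) refl)
    (λ pres s α β → mk⇔ (λ αβ → trans (pres α β) (cong (φ Φ) αβ))
                        (λ fαβ → φ-inj Φ (trans (sym (pres α β)) fαβ)))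

  module _ (pres : PreservesColours) where

    Mem-image⇔ : ∀ R {α β} → Mem X R α β ⇔ Mem X′ (image Φ R) (f α) (f β)
    Mem-image⇔ R {α} {β} = mk⇔ (λ Rαβ → col X α β , Rαβ , sym (pres α β))
                              (λ (s , Rs , φs) → subst R (φ-inj Φ (trans φs (pres α β))) Rs)

    BasisRel-image⇔ : ∀ s {α β} → BasisRel X s α β ⇔ BasisRel X′ (φ Φ s) (f α) (f β)
    BasisRel-image⇔ s {α} {β} = from IsIso⇔PreservesColours pres s α β

  module _ (iso : IsIso Φ f) (f-inj : Injective _≡_ _≡_ f) (f-surj : StrictlySurjective _≡_ f)
           (e0 e1 : Relation X) (e0-refl : Reflexive (Mem X e0)) where

    private
      pres = to IsIso⇔PreservesColours iso
      E0′ = Mem X′ (image Φ e0)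
      E1′ = Mem X′ (image Φ e1)

    isoPair : AdmissiblePair Φ e0 e1
    isoPair = record
      { F0          = f
      ; F0-wd       = λ _ _ → to (Mem-image⇔ pres e0)
      ; F0-inj      = λ _ _ → from (Mem-image⇔ pres e0)
      ; F0-surj     = λ y → let x , fx = f-surj y in
                            x , subst (E0′ (f x)) fx (to (Mem-image⇔ pres e0) e0-refl)
      ; F0-e1       = λ _ _ → Lift-transport {e′ = E0′} {s′ = E1′} f-surj
                              (Mem-image⇔ pres e0) (Mem-image⇔ pres e1)
      ; FΔ          = λ _ → f
      ; FΔ-wd       = λ _ _ _ _ _ → refl
      ; FΔ-into     = λ _ _ → to (Mem-image⇔ pres e1)
      ; FΔ-inj      = λ _ _ _ _ _ → f-inj
      ; FΔ-surj     = λ δ y δy → let x , fx = f-surj y in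
                            x , from (Mem-image⇔ pres e1) (subst (E1′ (f δ)) (sym fx) δy) , fx
      ; FΔ-cls-into = λ _ _ _ _ → to (Mem-image⇔ pres e0)
      ; FΔ-cls-onto = λ _ α y _ αy → let x , fx = f-surj y in
                            x , from (Mem-image⇔ pres e0) (subst (E0′ (f α)) (sym fx) αy) , fx
      ; FΔ-induced  = λ _ _ _ → to (Mem-image⇔ pres e0) e0-refl
      }

    isoPair-correct : Induces Φ e0 e1 isoPair f × F0Iso Φ e0 e1 isoPair × FΔIso Φ e0 e1 isoPair
    isoPair-correct =
      ((λ _ → to (Mem-image⇔ pres e0) e0-refl) , (λ _ _ _ → refl)) ,
      (λ s _ _ → Lift-transport {e′ = E0′} {s′ = BasisRel X′ (φ Φ s)} f-surj
                   (Mem-image⇔ pres e0) (BasisRel-image⇔ pres s)) ,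
      (λ _ s _ α β _ _ → iso s α β)

module _ {n n′} {X : CC n} {X′ : CC n′} (Φ : AlgIso X X′) {f : Fin n → Fin n′}
         {e0 e1 : Relation X} (P : AdmissiblePair Φ e0 e1) (induces : Induces Φ e0 e1 P f) where

  private
    E1 = Mem X e1
    f∼F0 = proj₁ induces
    f≡FΔ = proj₂ induces

  preservesColour-inside : Reflexive E1 → FΔIso Φ e0 e1 P →
                           ∀ {α β} → E1 α β → col X′ (f α) (f β) ≡ φ Φ (col X α β)
  preservesColour-inside e1-refl fΔ-iso {α} {β} αβ =
    subst₂ (BasisRel X′ (φ Φ (col X α β))) (sym (f≡FΔ α α e1-refl)) (sym (f≡FΔ α β αβ))
      (to (fΔ-iso α _ (α , β , e1-refl , αβ , refl) α β e1-refl αβ) refl)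

  preservesColour-outside : Reflexive (Mem X e0) → Condition X e1 e0 → F0Iso Φ e0 e1 P →
                            ∀ {α β} → ¬ E1 α β → col X′ (f α) (f β) ≡ φ Φ (col X α β)
  preservesColour-outside e0-refl cond f0-iso {α} {β} ¬αβ =
    sat′ (F0 P α , F0 P β , f∼F0 α , f∼F0 β , sat′ (to (f0-iso s α β) (α , β , e0-refl , e0-refl , refl)))
    where
    s = col X α β
    disjoint : ∀ γ δ → col X γ δ ≡ s → ¬ E1 γ δ
    disjoint _ _ γδ e1γδ = ¬αβ (subst e1 γδ e1γδ)
    sat′ : Saturated (Mem X′ (image Φ e0)) (BasisRel X′ (φ Φ s))
    sat′ with _ , (_ , blocks , _) , e0⊆r ← cond s disjoint =
      saturated-image Φ e0-refl (BlockUnion⇒Saturated blocks e0⊆r)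

  -- e1 need not be decidable, but equality of colours is, so the case split can be made under ¬¬.
  induced-preservesColours : Reflexive (Mem X e0) → Reflexive E1 → Condition X e1 e0 →
                             F0Iso Φ e0 e1 P → FΔIso Φ e0 e1 P → PreservesColours Φ
  induced-preservesColours e0-refl e1-refl cond f0-iso fΔ-iso α β =
    decidable-stable (_ ≟ _) λ ≢ → ¬¬-excluded-middle λ e1? → ≢ (cases e1?)
    where
    cases : Dec (E1 α β) → col X′ (f α) (f β) ≡ φ Φ (col X α β)
    cases (yes αβ) = preservesColour-inside e1-refl fΔ-iso αβ
    cases (no ¬αβ) = preservesColour-outside e0-refl cond f0-iso ¬αβ

theorem5p2 : ∀ {n n′} (X : CC n) (X′ : CC n′) → IsScheme X → IsScheme X′ →
    (e0 e1 : Relation X) → IsParabolic X e0 → IsParabolic X e1 →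
    Mem X e0 ⊆ᴿ Mem X e1 → Condition X e1 e0 →
    (Φ : AlgIso X X′) → (f : Fin n → Fin n′) → Bijective _≡_ _≡_ f →
    IsIso Φ f ⇔
      Σ (AdmissiblePair Φ e0 e1) (λ P →
        Induces Φ e0 e1 P f × F0Iso Φ e0 e1 P × FΔIso Φ e0 e1 P)
theorem5p2 X X′ _ _ e0 e1 e0-eqv e1-eqv _ cond Φ f (f-inj , f-surj) = mk⇔
  (λ iso → let f-surj′ = surjective⇒strictlySurjective _≡_ refl f-surj in
     isoPair Φ iso f-inj f-surj′ e0 e1 e0-refl , isoPair-correct Φ iso f-inj f-surj′ e0 e1 e0-refl)
  (λ (P , induces , f0-iso , fΔ-iso) → from (IsIso⇔PreservesColours Φ)
     (induced-preservesColours Φ P induces e0-refl e1-refl cond f0-iso fΔ-iso))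
  where
  e0-refl = IsEquivalence.refl e0-eqv
  e1-refl = IsEquivalence.refl e1-eqv
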